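{- The sequence $\alpha_{10},\alpha_{11},\alpha_{12},\dots$ converges $10$-adically; that is, for every positive integer $j$ there is $N$ such that $\alpha_n\equiv\alpha_{N}\pmod{10^j}$ for all $n\ge N$.
   Context: For a positive integer $a$ with decimal expansion $a=\sum_{i=0}^{k} c_i 10^i$, $c_i\in\{0,\dots,9\}$, $c_k\neq 0$, and an integer $b\ge 10$, let $a\_b:=\sum_{i=0}^{k} c_i b^i$ (the decimal digit string of $a$ interpreted in base $b$). Define $\alpha_{10}=10$ and, for $n\ge 11$, $\alpha_n = 10\_(11\_(12\_(\cdots\_((n-1)\_n)\cdots)))$. -}

module Defs where

open import Data.Nat using (ℕ; zero; suc; _+_; _*_; _∸_)
open import Data.Nat.DivMod using (_/_; _%_)

-- reinterp-fuel f a b : the decimal digit string of a read in base b,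
-- computed by peeling off decimal digits; fuel f ≥ number of digits suffices.
reinterp-fuel : ℕ → ℕ → ℕ → ℕ
reinterp-fuel zero    a b = 0
reinterp-fuel (suc f) a b = a % 10 + b * reinterp-fuel f (a / 10) b

-- a _ b  (a ≥ 1 has at most a decimal digits, so fuel a suffices; 0 _ b = 0)
_⟨_⟩ : ℕ → ℕ → ℕ
a ⟨ b ⟩ = reinterp-fuel a a b

tower : ℕ → ℕ → ℕ
tower n zero    = n
tower n (suc i) = (n ∸ suc i) ⟨ tower n i ⟩

-- α n for n ≥ 10:  α 10 = 10,  α n = 10_(11_(…_((n-1)_n)…))
α : ℕ → ℕ
α n = tower n (n ∸ 10)

open import Data.Nat.Properties using (m^n≢0)
open import Data.Nat using (_^_)
open import Relation.Binary.PropositionalEquality using (_≡_)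

_≡_mod10^_ : ℕ → ℕ → ℕ → Set
x ≡ y mod10^ j = _%_ x (10 ^ j) {{m^n≢0 10 j}} ≡ _%_ y (10 ^ j) {{m^n≢0 10 j}}

{-# OPTIONS --safe #-}

-- Write f_a(b) = a_b, so that α_n = f_10(f_11(…f_{n-1}(n)…)). Each f_a is a polynomial in b with
-- natural coefficients, so it preserves congruences modulo any m; and for a = c·10^e with a single
-- digit c it is b ↦ c·b^e, which turns a congruence mod m into one mod c·m. Hence if some composite
-- f_a ∘ … ∘ f_{a+k} with a = 2·10^(e+1) is constant mod m, extending it down through 5·10^e and
-- then 2·10^e makes it constant mod 5·2·m = 10m. Starting from mod 1 and descending j times
-- yields K with f_10 ∘ … ∘ f_{9+K} constant mod 10^j, so α_n ≡ α_{10+K} (mod 10^j) for n ≥ 10 + K.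

module Submission where

open import Defs
open import Data.Nat using (ℕ; zero; suc; _+_; _*_; _∸_; _^_; _≤_; _<_; z≤n; s≤s; z<s; s≤s⁻¹; NonZero; _<?_)
open import Data.Nat.Properties
open import Data.Nat.DivMod using (_/_; _%_; [m+kn]%n≡m%n; m*n%n≡0; m*n/n≡m; m<n⇒m%n≡m; m<n⇒m/n≡0)
open import Data.Nat.Tactic.RingSolver using (solve-∀)
open import Data.Product using (∃-syntax; _×_; _,_)
open import Data.Sum using (inj₁; inj₂)
open import Relation.Binary.PropositionalEquality
open import Relation.Nullary.Decidable using (from-yes)

-- Phrased without subtraction or division, so the modulus needs no NonZero instance.
infix 4 _≡_mod_

_≡_mod_ : ℕ → ℕ → ℕ → Set
x ≡ y mod m = ∃[ p ] ∃[ q ] x + p * m ≡ y + q * m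

≡-mod-refl : ∀ {m} x → x ≡ x mod m
≡-mod-refl x = 0 , 0 , refl

≡-mod-1 : ∀ x y → x ≡ y mod 1
≡-mod-1 x y = y , x , swap x y
  where
  swap : ∀ x y → x + y * 1 ≡ y + x * 1
  swap = solve-∀

+-cong-mod : ∀ {m x y u v} → x ≡ y mod m → u ≡ v mod m → x + u ≡ y + v mod m
+-cong-mod {m} {x} {y} {u} {v} (p , q , x≡y) (r , s , u≡v) = p + r , q + s , (begin
  x + u + (p + r) * m       ≡⟨ regroup x u p r m ⟩
  (x + p * m) + (u + r * m) ≡⟨ cong₂ _+_ x≡y u≡v ⟩
  (y + q * m) + (v + s * m) ≡⟨ regroup y v q s m ⟨
  y + v + (q + s) * m       ∎)
  where
  open ≡-Reasoning
  regroup : ∀ a b c d m → a + b + (c + d) * m ≡ (a + c * m) + (b + d * m)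
  regroup = solve-∀

*-cong-mod : ∀ {m x y u v} → x ≡ y mod m → u ≡ v mod m → x * u ≡ y * v mod m
*-cong-mod {m} {x} {y} {u} {v} (p , q , x≡y) (r , s , u≡v) =
  x * r + p * u + p * r * m , y * s + q * v + q * s * m , (begin
  x * u + (x * r + p * u + p * r * m) * m ≡⟨ expand x u p r m ⟩
  (x + p * m) * (u + r * m)               ≡⟨ cong₂ _*_ x≡y u≡v ⟩
  (y + q * m) * (v + s * m)               ≡⟨ expand y v q s m ⟨
  y * v + (y * s + q * v + q * s * m) * m ∎)
  where
  open ≡-Reasoning
  expand : ∀ a b c d m → a * b + (a * d + c * b + c * d * m) * m ≡ (a + c * m) * (b + d * m)
  expand = solve-∀

^-cong-mod : ∀ {m x y} e → x ≡ y mod m → x ^ e ≡ y ^ e mod m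
^-cong-mod zero    x≡y = ≡-mod-refl 1
^-cong-mod (suc e) x≡y = *-cong-mod x≡y (^-cong-mod e x≡y)

*-scale-mod : ∀ {m x y} c → x ≡ y mod m → c * x ≡ c * y mod c * m
*-scale-mod {m} {x} {y} c (p , q , x≡y) = p , q , (begin
  c * x + p * (c * m) ≡⟨ factor c x p m ⟩
  c * (x + p * m)     ≡⟨ cong (c *_) x≡y ⟩
  c * (y + q * m)     ≡⟨ factor c y q m ⟨
  c * y + q * (c * m) ∎)
  where
  open ≡-Reasoning
  factor : ∀ c x p m → c * x + p * (c * m) ≡ c * (x + p * m)
  factor = solve-∀

≡-mod⇒%≡ : ∀ {m x y} .{{_ : NonZero m}} → x ≡ y mod m → x % m ≡ y % m
≡-mod⇒%≡ {m} {x} {y} (p , q , x≡y) = begin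
  x % m           ≡⟨ [m+kn]%n≡m%n x p m ⟨
  (x + p * m) % m ≡⟨ cong (_% m) x≡y ⟩
  (y + q * m) % m ≡⟨ [m+kn]%n≡m%n y q m ⟩
  y % m           ∎
  where open ≡-Reasoning

reinterp-fuel-cong : ∀ {m u v} f a → u ≡ v mod m → reinterp-fuel f a u ≡ reinterp-fuel f a v mod m
reinterp-fuel-cong zero    a u≡v = ≡-mod-refl 0
reinterp-fuel-cong (suc f) a u≡v =
  +-cong-mod (≡-mod-refl (a % 10)) (*-cong-mod u≡v (reinterp-fuel-cong f (a / 10) u≡v))

⟨⟩-cong : ∀ {m u v} a → u ≡ v mod m → a ⟨ u ⟩ ≡ a ⟨ v ⟩ mod m
⟨⟩-cong a = reinterp-fuel-cong a a

reinterp-fuel-zero : ∀ f b → reinterp-fuel f 0 b ≡ 0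
reinterp-fuel-zero zero    b = refl
reinterp-fuel-zero (suc f) b = trans (cong (b *_) (reinterp-fuel-zero f b)) (*-zeroʳ b)

reinterp-fuel-digit*10^ : ∀ {c} f e b → c < 10 → e < f → reinterp-fuel f (c * 10 ^ e) b ≡ c * b ^ e
reinterp-fuel-digit*10^ {c} (suc f) zero b c<10 _ = begin
  c * 1 % 10 + b * reinterp-fuel f (c * 1 / 10) b ≡⟨ cong (λ d → d % 10 + b * reinterp-fuel f (d / 10) b) (*-identityʳ c) ⟩
  c % 10 + b * reinterp-fuel f (c / 10) b         ≡⟨ cong₂ (λ r d → r + b * reinterp-fuel f d b) (m<n⇒m%n≡m c<10) (m<n⇒m/n≡0 c<10) ⟩
  c + b * reinterp-fuel f 0 b                     ≡⟨ cong (λ r → c + b * r) (reinterp-fuel-zero f b) ⟩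
  c + b * 0                                       ≡⟨ cong (c +_) (*-zeroʳ b) ⟩
  c + 0                                           ≡⟨ +-identityʳ c ⟩
  c                                               ≡⟨ *-identityʳ c ⟨
  c * 1                                           ∎
  where open ≡-Reasoning
reinterp-fuel-digit*10^ {c} (suc f) (suc e) b c<10 (s≤s e<f) = begin
  reinterp-fuel (suc f) (c * (10 * 10 ^ e)) b             ≡⟨ cong (λ a → reinterp-fuel (suc f) a b) (shift c (10 ^ e)) ⟩
  c * 10 ^ e * 10 % 10 + b * reinterp-fuel f (c * 10 ^ e * 10 / 10) b
    ≡⟨ cong₂ (λ r a → r + b * reinterp-fuel f a b) (m*n%n≡0 (c * 10 ^ e) 10) (m*n/n≡m (c * 10 ^ e) 10) ⟩
  b * reinterp-fuel f (c * 10 ^ e) b                      ≡⟨ cong (b *_) (reinterp-fuel-digit*10^ f e b c<10 e<f) ⟩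
  b * (c * b ^ e)                                         ≡⟨ x*[c*y]≡c*[x*y] b c (b ^ e) ⟩
  c * (b * b ^ e)                                         ∎
  where
  open ≡-Reasoning
  shift : ∀ c x → c * (10 * x) ≡ c * x * 10
  shift = solve-∀
  x*[c*y]≡c*[x*y] : ∀ x c y → x * (c * y) ≡ c * (x * y)
  x*[c*y]≡c*[x*y] = solve-∀

n<10^n : ∀ n → n < 10 ^ n
n<10^n zero    = z<s
n<10^n (suc n) = ≤-<-trans (n<10^n n) (^-monoʳ-< 10 (from-yes (1 <? 10)) (n<1+n n))

digit*10^⟨⟩ : ∀ {c} e b → c < 10 → (c * 10 ^ e) ⟨ b ⟩ ≡ c * b ^ e
digit*10^⟨⟩ {zero}    e b _    = refl
digit*10^⟨⟩ {c@(suc _)} e b c<10 =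
  reinterp-fuel-digit*10^ (c * 10 ^ e) e b c<10 (<-≤-trans (n<10^n e) (m≤n*m (10 ^ e) c))

nest : ℕ → ℕ → ℕ → ℕ
nest a zero    x = x
nest a (suc k) x = a ⟨ nest (suc a) k x ⟩

nest-+ : ∀ a k l x → nest a (k + l) x ≡ nest a k (nest (a + k) l x)
nest-+ a zero    l x = cong (λ b → nest b l x) (sym (+-identityʳ a))
nest-+ a (suc k) l x = cong (a ⟨_⟩) (trans (nest-+ (suc a) k l x)
  (cong (λ b → nest (suc a) k (nest b l x)) (sym (+-suc a k))))

tower≡nest : ∀ {n i} → i ≤ n → tower n i ≡ nest (n ∸ i) i n
tower≡nest {n} {zero}  _   = refl
tower≡nest {n} {suc i} i<n = cong ((n ∸ suc i) ⟨_⟩) (trans (tower≡nest (<⇒≤ i<n))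
  (cong (λ a → nest a i n) (+-∸-assoc 1 i<n)))

α≡nest : ∀ K {n} → 10 + K ≤ n → α n ≡ nest 10 K (nest (10 + K) (n ∸ (10 + K)) n)
α≡nest K {n} 10+K≤n = begin
  tower n (n ∸ 10)                           ≡⟨ tower≡nest (m∸n≤m n 10) ⟩
  nest (n ∸ (n ∸ 10)) (n ∸ 10) n             ≡⟨ cong (λ a → nest a (n ∸ 10) n) (m∸[m∸n]≡n (≤-trans (m≤m+n 10 K) 10+K≤n)) ⟩
  nest 10 (n ∸ 10) n                         ≡⟨ cong (λ k → nest 10 k n) n∸10≡K+[n∸[10+K]] ⟩
  nest 10 (K + (n ∸ (10 + K))) n             ≡⟨ nest-+ 10 K (n ∸ (10 + K)) n ⟩
  nest 10 K (nest (10 + K) (n ∸ (10 + K)) n) ∎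
  where
  open ≡-Reasoning
  n∸10≡K+[n∸[10+K]] : n ∸ 10 ≡ K + (n ∸ (10 + K))
  n∸10≡K+[n∸[10+K]] = trans (sym (m+[n∸m]≡n (∸-monoˡ-≤ 10 10+K≤n))) (cong (K +_) (∸-+-assoc n 10 K))

NestConstant : ℕ → ℕ → ℕ → Set
NestConstant a k m = ∀ x y → nest a k x ≡ nest a k y mod m

NestStabilises : ℕ → ℕ → Set
NestStabilises a m = ∃[ k ] NestConstant a k m

nestStabilises-1 : ∀ a → NestStabilises a 1
nestStabilises-1 a = 0 , ≡-mod-1

nestStabilises-suc : ∀ {a m} → NestStabilises (suc a) m → NestStabilises a m
nestStabilises-suc {a} (k , const) = suc k , λ x y → ⟨⟩-cong a (const x y)

nestStabilises-≤ : ∀ {a b m} → a ≤ b → NestStabilises b m → NestStabilises a m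
nestStabilises-≤ {b = zero}  z≤n  stable = stable
nestStabilises-≤ {b = suc b} a≤1+b stable with m≤n⇒m<n∨m≡n a≤1+b
... | inj₁ a<1+b = nestStabilises-≤ (s≤s⁻¹ a<1+b) (nestStabilises-suc stable)
... | inj₂ refl  = stable

nestStabilises-digit*10^ : ∀ {c e m} → c < 10 →
  NestStabilises (suc (c * 10 ^ e)) m → NestStabilises (c * 10 ^ e) (c * m)
nestStabilises-digit*10^ {c} {e} {m} c<10 (k , const) = suc k , λ x y →
  subst₂ (λ u v → u ≡ v mod c * m) (sym (digit*10^⟨⟩ e _ c<10)) (sym (digit*10^⟨⟩ e _ c<10))
    (*-scale-mod c (^-cong-mod e (const x y)))

nestStabilises-2*10^[1+e]⇒2*10^e : ∀ e {m} →
  NestStabilises (2 * 10 ^ suc e) m → NestStabilises (2 * 10 ^ e) (10 * m)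
nestStabilises-2*10^[1+e]⇒2*10^e e {m} stable =
  subst (NestStabilises (2 * 10 ^ e)) (sym (*-assoc 2 5 m)) at-2*10^e
  where
  instance _ = m^n≢0 10 e
  at-5*10^e : NestStabilises (5 * 10 ^ e) (5 * m)
  at-5*10^e = nestStabilises-digit*10^ {5} {e} (from-yes (5 <? 10)) (nestStabilises-≤
    (≤-trans (*-monoˡ-< (10 ^ e) (from-yes (5 <? 20))) (≤-reflexive (*-assoc 2 10 (10 ^ e)))) stable)
  at-2*10^e : NestStabilises (2 * 10 ^ e) (2 * (5 * m))
  at-2*10^e = nestStabilises-digit*10^ {2} {e} (from-yes (2 <? 10))
    (nestStabilises-≤ (*-monoˡ-< (10 ^ e) (from-yes (2 <? 5))) at-5*10^e)

nestStabilises-2*10^ : ∀ i e → NestStabilises (2 * 10 ^ e) (10 ^ i)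
nestStabilises-2*10^ zero    e = nestStabilises-1 (2 * 10 ^ e)
nestStabilises-2*10^ (suc i) e = nestStabilises-2*10^[1+e]⇒2*10^e e (nestStabilises-2*10^ i (suc e))

nestStabilises-10 : ∀ j → NestStabilises 10 (10 ^ j)
nestStabilises-10 j = nestStabilises-≤ (m≤m+n 10 10) (nestStabilises-2*10^ j 1)

α-stable : ∀ {j K} → NestConstant 10 K (10 ^ j) → ∀ n → 10 + K ≤ n → α n ≡ α (10 + K) mod10^ j
α-stable {j} {K} const n 10+K≤n = ≡-mod⇒%≡ {{m^n≢0 10 j}} (subst₂ (λ u v → u ≡ v mod 10 ^ j)
  (sym (α≡nest K 10+K≤n)) (sym (α≡nest K ≤-refl)) (const _ _))

-- The argument works for j = 0 too.
theorem4 : (j : ℕ) → 1 ≤ j →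
    ∃[ N ] (10 ≤ N × ((n : ℕ) → N ≤ n → α n ≡ α N mod10^ j))
theorem4 j _ = let K , const = nestStabilises-10 j in 10 + K , m≤m+n 10 K , α-stable {j} {K} const
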